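{- Let $D$ be a pebbling distribution on a path. If an inner vertex of the path is not $2$-reachable under $D$, then at least one of its two neighbors is not $2$-reachable under $D$ either.
   Context: A pebbling distribution on a graph is a function $D:V\to\mathbb{Z}_{\ge0}$. A pebbling move removes two pebbles from a vertex having at least two pebbles and places one on an adjacent vertex. A vertex $v$ is $2$-reachable under $D$ if some sequence of legal pebbling moves results in at least two pebbles on $v$. -}

module Defs where

open import Data.Nat using (ℕ; zero; suc; _+_; _∸_; _≤_; _<_)
open import Data.Fin using (Fin; toℕ; _≟_)
open import Data.Sum using (_⊎_)
open import Data.Product using (∃; _×_)
open import Relation.Nullary using (¬_; yes; no)
open import Relation.Binary.PropositionalEquality using (_≡_)
open import Relation.Binary.Construct.Closure.ReflexiveTransitive using (Star)

Distribution : ℕ → Set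
Distribution n = Fin n → ℕ

PathAdj : {n : ℕ} → Fin n → Fin n → Set
PathAdj u w = (suc (toℕ u) ≡ toℕ w) ⊎ (suc (toℕ w) ≡ toℕ u)

moveDist : {n : ℕ} → Fin n → Fin n → Distribution n → Distribution n
moveDist u w D x with x ≟ u | x ≟ w
... | yes _ | _     = D x ∸ 2
... | no _  | yes _ = suc (D x)
... | no _  | no _  = D x

data Move {n : ℕ} (Adj : Fin n → Fin n → Set) : Distribution n → Distribution n → Set where
  move : ∀ {D} (u w : Fin n) → Adj u w → 2 ≤ D u → Move Adj D (moveDist u w D)

Reaches : {n : ℕ} → (Fin n → Fin n → Set) → Distribution n → Distribution n → Set
Reaches Adj = Star (Move Adj)

TwoReachable : {n : ℕ} → (Fin n → Fin n → Set) → Distribution n → Fin n → Set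
TwoReachable Adj D v = ∃ λ D' → Reaches Adj D D' × 2 ≤ D' v

-- On the path 0 — 1 — … — n-1 with distribution g, the pebbles that the
-- vertices left of t can deliver to t are inL g t = ⌊(g(t-1) + inL g (t-1))/2⌋
-- (push everything greedily to the right); inR is the mirror image.  The
-- capacity of t is  g t + inL g t + inR g t.  We prove
--   (1) a pebbling move never increases the capacity of a vertex t: an edge
--       lies weakly on one side of t, and on that side the "load"
--       g t + inL g t (resp. g t + inR g t) cannot grow (`cap-shift`);
--   (2) the greedy flows are realised by actual moves, so a vertex of
--       capacity at least 2 is 2-reachable (`reachable`).
-- Hence v is 2-reachable iff its capacity is ≥ 2.  For consecutive vertices
-- u, v, w all three capacities are expressions in A = left load at u,
-- c = g v and B = right load at w, and capacity(v) ≤ 1 forces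
-- capacity(u) ≤ 1 or capacity(w) ≤ 1 by elementary arithmetic
-- (`capacity-core`), which is the theorem.  Flows are computed on the
-- extension of a distribution by zeros to all of ℕ (`ext`).
module Submission where

open import Defs
open import Data.Nat
open import Data.Nat.Properties
open import Data.Fin using (Fin; toℕ; fromℕ<) renaming (_≟_ to _≟ᶠ_)
open import Data.Fin.Properties using (toℕ-fromℕ<; fromℕ<-toℕ; toℕ<n; toℕ-injective)
open import Data.Sum using (_⊎_; inj₁; inj₂)
import Data.Sum as Sum
open import Data.Product using (∃; _×_; _,_)
open import Data.Empty using (⊥-elim)
open import Function using (_∘_)
open import Relation.Nullary using (¬_; yes; no)
open import Relation.Binary.PropositionalEquality
open import Relation.Binary.Construct.Closure.ReflexiveTransitive using (ε; _◅_; _◅◅_)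
open import Algebra.Properties.CommutativeSemigroup +-commutativeSemigroup
  using (xy∙z≈y∙xz; xy∙z≈xz∙y)

-- Adjacency in the infinite path on ℕ; `PathAdj u w` is `Adj (toℕ u) (toℕ w)`.
Adj : ℕ → ℕ → Set
Adj a b = suc a ≡ b ⊎ suc b ≡ a

adj⇒≢ : ∀ {a b} → Adj a b → a ≢ b
adj⇒≢ (inj₁ 1+a≡b) a≡b = 1+n≰n (≤-reflexive (trans 1+a≡b (sym a≡b)))
adj⇒≢ (inj₂ 1+b≡a) a≡b = 1+n≰n (≤-reflexive (trans 1+b≡a a≡b))

adj-side : ∀ {a b} t → Adj a b → (a ≤ t × b ≤ t) ⊎ (t ≤ a × t ≤ b)
adj-side {a} t (inj₁ refl) with suc a ≤? t
... | yes 1+a≤t = inj₁ (≤-trans (n≤1+n a) 1+a≤t , 1+a≤t)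
... | no  1+a≰t = inj₂ (≤-pred (≰⇒> 1+a≰t) , m≤n⇒m≤1+n (≤-pred (≰⇒> 1+a≰t)))
adj-side {b = b} t (inj₂ refl) with suc b ≤? t
... | yes 1+b≤t = inj₁ (1+b≤t , ≤-trans (n≤1+n b) 1+b≤t)
... | no  1+b≰t = inj₂ (m≤n⇒m≤1+n (≤-pred (≰⇒> 1+b≰t)) , ≤-pred (≰⇒> 1+b≰t))

shift : ℕ → ℕ → (ℕ → ℕ) → ℕ → ℕ
shift a b g k with k ≟ a | k ≟ b
... | yes _ | _     = g k ∸ 2
... | no _  | yes _ = suc (g k)
... | no _  | no _  = g k

shift-source : ∀ a b g → shift a b g a ≡ g a ∸ 2
shift-source a b g with a ≟ a
... | yes _   = refl
... | no  a≢a = ⊥-elim (a≢a refl)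

shift-target : ∀ a b g → a ≢ b → shift a b g b ≡ suc (g b)
shift-target a b g a≢b with b ≟ a | b ≟ b
... | yes b≡a | _       = ⊥-elim (a≢b (sym b≡a))
... | no _    | yes _   = refl
... | no _    | no  b≢b = ⊥-elim (b≢b refl)

shift-other : ∀ a b g k → k ≢ a → k ≢ b → shift a b g k ≡ g k
shift-other a b g k k≢a k≢b with k ≟ a | k ≟ b
... | yes k≡a | _       = ⊥-elim (k≢a k≡a)
... | no _    | yes k≡b = ⊥-elim (k≢b k≡b)
... | no _    | no _    = refl

shift-below : ∀ {a b k} g → k < a → k < b → shift a b g k ≡ g k
shift-below g k<a k<b = shift-other _ _ g _ (<⇒≢ k<a) (<⇒≢ k<b)

shift-above : ∀ {a b k} g → a < k → b < k → shift a b g k ≡ g k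
shift-above g a<k b<k = shift-other _ _ g _ (>⇒≢ a<k) (>⇒≢ b<k)

inL : (ℕ → ℕ) → ℕ → ℕ
inL g zero    = 0
inL g (suc t) = ⌊ g t + inL g t /2⌋

-- inR g t m: pebbles that the positions t+1 … t+m can deliver to t.
inR : (ℕ → ℕ) → ℕ → ℕ → ℕ
inR g t zero    = 0
inR g t (suc m) = ⌊ g (suc t) + inR g (suc t) m /2⌋

loadL : (ℕ → ℕ) → ℕ → ℕ
loadL g t = g t + inL g t

loadR : (ℕ → ℕ) → ℕ → ℕ → ℕ
loadR g t m = g t + inR g t m

cap : (ℕ → ℕ) → ℕ → ℕ → ℕ
cap g t m = g t + inL g t + inR g t m

cap-split : ∀ g t m → cap g t m ≡ inL g t + loadR g t m
cap-split g t m = xy∙z≈y∙xz (g t) (inL g t) (inR g t m)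

inL-local : ∀ {g h} t → (∀ {k} → k < t → g k ≡ h k) → inL g t ≡ inL h t
inL-local zero    g≗h = refl
inL-local (suc t) g≗h =
  cong ⌊_/2⌋ (cong₂ _+_ (g≗h (n<1+n t)) (inL-local t (g≗h ∘ m<n⇒m<1+n)))

inR-local : ∀ {g h} t m → (∀ {k} → t < k → g k ≡ h k) → inR g t m ≡ inR h t m
inR-local t zero    g≗h = refl
inR-local t (suc m) g≗h =
  cong ⌊_/2⌋ (cong₂ _+_ (g≗h (n<1+n t)) (inR-local (suc t) m (g≗h ∘ <-trans (n<1+n t))))

cap-cong : ∀ {g h} t m → (∀ k → g k ≡ h k) → cap g t m ≡ cap h t m
cap-cong t m g≗h =
  cong₂ _+_ (cong₂ _+_ (g≗h t) (inL-local t (λ {k} _ → g≗h k))) (inR-local t m (λ {k} _ → g≗h k))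

half-suc : ∀ x → ⌊ suc x /2⌋ ≤ suc ⌊ x /2⌋
half-suc x = ⌊n/2⌋-mono (n≤1+n (suc x))

-- Spending two pebbles at a vertex that receives at most one back.
spend-two : ∀ {x y z} → 2 ≤ x → y ≤ suc z → x ∸ 2 + y ≤ x + z
spend-two {suc (suc x)} {z = z} (s≤s (s≤s z≤n)) y≤1+z =
  ≤-trans (+-monoʳ-≤ x y≤1+z) (≤-trans (≤-reflexive (+-suc x z)) (n≤1+n _))

-- Receiving the pebble bought with two pebbles of the neighbour.
receive-one : ∀ x {y} z → 2 ≤ y → suc x + ⌊ y ∸ 2 + z /2⌋ ≡ x + ⌊ y + z /2⌋
receive-one x z (s≤s (s≤s _)) = sym (+-suc x _)

loadL-step : ∀ {a b} s g → suc s ≢ a → suc s ≢ b →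
  loadL (shift a b g) s ≤ loadL g s → loadL (shift a b g) (suc s) ≤ loadL g (suc s)
loadL-step s g ≢a ≢b le = +-mono-≤ (≤-reflexive (shift-other _ _ g _ ≢a ≢b)) (⌊n/2⌋-mono le)

loadL-shift : ∀ {a b} t g → Adj a b → 2 ≤ g a → a ≤ t → b ≤ t →
  loadL (shift a b g) t ≤ loadL g t
loadL-shift zero g (inj₁ refl) _ _ ()
loadL-shift zero g (inj₂ refl) _ () _
loadL-shift {a} (suc s) g (inj₁ refl) 2≤ga _ 1+a≤1+s with m≤n⇒m<n∨m≡n 1+a≤1+s
... | inj₂ refl = ≤-reflexive (begin
  shift a (suc a) g (suc a) + ⌊ shift a (suc a) g a + inL (shift a (suc a) g) a /2⌋
    ≡⟨ cong₂ (λ x y → x + ⌊ y + inL (shift a (suc a) g) a /2⌋)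
             (shift-target a _ g (<⇒≢ (n<1+n a))) (shift-source a _ g) ⟩
  suc (g (suc a)) + ⌊ g a ∸ 2 + inL (shift a (suc a) g) a /2⌋
    ≡⟨ cong (λ y → suc (g (suc a)) + ⌊ g a ∸ 2 + y /2⌋)
            (inL-local a (λ k<a → shift-below g k<a (m<n⇒m<1+n k<a))) ⟩
  suc (g (suc a)) + ⌊ g a ∸ 2 + inL g a /2⌋
    ≡⟨ receive-one (g (suc a)) (inL g a) 2≤ga ⟩
  loadL g (suc a) ∎)
  where open ≡-Reasoning
... | inj₁ 1+a<1+s = loadL-step s g (>⇒≢ (m<n⇒m<1+n (≤-pred 1+a<1+s))) (>⇒≢ 1+a<1+s)
  (loadL-shift s g (inj₁ refl) 2≤ga (≤-trans (n≤1+n a) (≤-pred 1+a<1+s)) (≤-pred 1+a<1+s))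
loadL-shift {b = b} (suc s) g (inj₂ refl) 2≤ga 1+b≤1+s _ with m≤n⇒m<n∨m≡n 1+b≤1+s
... | inj₂ refl = begin
  shift (suc b) b g (suc b) + ⌊ shift (suc b) b g b + inL (shift (suc b) b g) b /2⌋
    ≡⟨ cong₂ (λ x y → x + ⌊ y + inL (shift (suc b) b g) b /2⌋)
             (shift-source (suc b) b g) (shift-target (suc b) b g (>⇒≢ (n<1+n b))) ⟩
  g (suc b) ∸ 2 + ⌊ suc (g b) + inL (shift (suc b) b g) b /2⌋
    ≡⟨ cong (λ y → g (suc b) ∸ 2 + ⌊ suc (g b) + y /2⌋)
            (inL-local b (λ k<b → shift-below g (m<n⇒m<1+n k<b) k<b)) ⟩
  g (suc b) ∸ 2 + ⌊ suc (loadL g b) /2⌋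
    ≤⟨ spend-two 2≤ga (half-suc (loadL g b)) ⟩
  loadL g (suc b) ∎
  where open ≤-Reasoning
... | inj₁ 1+b<1+s = loadL-step s g (>⇒≢ 1+b<1+s) (>⇒≢ (m<n⇒m<1+n (≤-pred 1+b<1+s)))
  (loadL-shift s g (inj₂ refl) 2≤ga (≤-pred 1+b<1+s) (≤-trans (n≤1+n b) (≤-pred 1+b<1+s)))

loadR-step : ∀ {a b} t m g → t ≢ a → t ≢ b →
  loadR (shift a b g) (suc t) m ≤ loadR g (suc t) m →
  loadR (shift a b g) t (suc m) ≤ loadR g t (suc m)
loadR-step t m g ≢a ≢b le = +-mono-≤ (≤-reflexive (shift-other _ _ g _ ≢a ≢b)) (⌊n/2⌋-mono le)

loadR-shift : ∀ {a b} t m g → Adj a b → 2 ≤ g a → t ≤ a → t ≤ b → a ≤ t + m →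
  loadR (shift a b g) t m ≤ loadR g t m
loadR-shift t zero g adj 2≤ga t≤a _ a≤t+0
  with ≤-antisym t≤a (≤-trans a≤t+0 (≤-reflexive (+-identityʳ t)))
... | refl = +-monoˡ-≤ 0 (≤-trans (≤-reflexive (shift-source t _ g)) (m∸n≤m (g t) 2))
loadR-shift t (suc m) g (inj₁ refl) 2≤ga t≤a _ a≤t+1+m with m≤n⇒m<n∨m≡n t≤a
... | inj₂ refl = begin
  shift t (suc t) g t + ⌊ shift t (suc t) g (suc t) + inR (shift t (suc t) g) (suc t) m /2⌋
    ≡⟨ cong₂ (λ x y → x + ⌊ y + inR (shift t (suc t) g) (suc t) m /2⌋)
             (shift-source t _ g) (shift-target t _ g (<⇒≢ (n<1+n t))) ⟩
  g t ∸ 2 + ⌊ suc (g (suc t)) + inR (shift t (suc t) g) (suc t) m /2⌋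
    ≡⟨ cong (λ y → g t ∸ 2 + ⌊ suc (g (suc t)) + y /2⌋)
            (inR-local (suc t) m (λ 1+t<k → shift-above g (<-trans (n<1+n t) 1+t<k) 1+t<k)) ⟩
  g t ∸ 2 + ⌊ suc (loadR g (suc t) m) /2⌋
    ≤⟨ spend-two 2≤ga (half-suc (loadR g (suc t) m)) ⟩
  loadR g t (suc m) ∎
  where open ≤-Reasoning
... | inj₁ t<a = loadR-step t m g (<⇒≢ t<a) (<⇒≢ (m<n⇒m<1+n t<a))
  (loadR-shift (suc t) m g (inj₁ refl) 2≤ga t<a (m≤n⇒m≤1+n t<a)
     (≤-trans a≤t+1+m (≤-reflexive (+-suc t m))))
loadR-shift t (suc m) g (inj₂ refl) 2≤ga _ t≤b a≤t+1+m with m≤n⇒m<n∨m≡n t≤b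
... | inj₂ refl = ≤-reflexive (begin
  shift (suc t) t g t + ⌊ shift (suc t) t g (suc t) + inR (shift (suc t) t g) (suc t) m /2⌋
    ≡⟨ cong₂ (λ x y → x + ⌊ y + inR (shift (suc t) t g) (suc t) m /2⌋)
             (shift-target (suc t) t g (>⇒≢ (n<1+n t))) (shift-source (suc t) t g) ⟩
  suc (g t) + ⌊ g (suc t) ∸ 2 + inR (shift (suc t) t g) (suc t) m /2⌋
    ≡⟨ cong (λ y → suc (g t) + ⌊ g (suc t) ∸ 2 + y /2⌋)
            (inR-local (suc t) m (λ 1+t<k → shift-above g 1+t<k (<-trans (n<1+n t) 1+t<k))) ⟩
  suc (g t) + ⌊ g (suc t) ∸ 2 + inR g (suc t) m /2⌋
    ≡⟨ receive-one (g t) (inR g (suc t) m) 2≤ga ⟩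
  loadR g t (suc m) ∎)
  where open ≡-Reasoning
... | inj₁ t<b = loadR-step t m g (<⇒≢ (m<n⇒m<1+n t<b)) (<⇒≢ t<b)
  (loadR-shift (suc t) m g (inj₂ refl) 2≤ga (m≤n⇒m≤1+n t<b) t<b
     (≤-trans a≤t+1+m (≤-reflexive (+-suc t m))))

cap-shift : ∀ {a b} t m g → Adj a b → 2 ≤ g a → a ≤ t + m →
  cap (shift a b g) t m ≤ cap g t m
cap-shift {a} {b} t m g adj 2≤ga a≤t+m with adj-side t adj
... | inj₁ (a≤t , b≤t) =
  +-mono-≤ (loadL-shift t g adj 2≤ga a≤t b≤t)
           (≤-reflexive (inR-local t m (λ t<k → shift-above g (≤-<-trans a≤t t<k) (≤-<-trans b≤t t<k))))
... | inj₂ (t≤a , t≤b) = begin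
  cap (shift a b g) t m                        ≡⟨ cap-split (shift a b g) t m ⟩
  inL (shift a b g) t + loadR (shift a b g) t m
    ≤⟨ +-mono-≤ (≤-reflexive (inL-local t (λ k<t → shift-below g (<-≤-trans k<t t≤a) (<-≤-trans k<t t≤b))))
                (loadR-shift t m g adj 2≤ga t≤a t≤b a≤t+m) ⟩
  inL g t + loadR g t m                        ≡⟨ cap-split g t m ⟨
  cap g t m                                    ∎
  where open ≤-Reasoning

ext : ∀ {n} → Distribution n → ℕ → ℕ
ext {n} D k with k <? n
... | yes k<n = D (fromℕ< k<n)
... | no  _   = 0

ext-in : ∀ {n} (D : Distribution n) {k} (k<n : k < n) → ext D k ≡ D (fromℕ< k<n)
ext-in {n} D {k} k<n with k <? n
... | yes _   = refl
... | no  k≮n = ⊥-elim (k≮n k<n)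

ext-out : ∀ {n} (D : Distribution n) {k} → ¬ k < n → ext D k ≡ 0
ext-out {n} D {k} k≮n with k <? n
... | yes k<n = ⊥-elim (k≮n k<n)
... | no _    = refl

ext-toℕ : ∀ {n} (D : Distribution n) x → ext D (toℕ x) ≡ D x
ext-toℕ D x = trans (ext-in D (toℕ<n x)) (cong D (fromℕ<-toℕ x (toℕ<n x)))

shift-toℕ : ∀ {n} (a b x : Fin n) D →
  shift (toℕ a) (toℕ b) (ext D) (toℕ x) ≡ moveDist a b D x
shift-toℕ a b x D with x ≟ᶠ a | x ≟ᶠ b | toℕ x ≟ toℕ a | toℕ x ≟ toℕ b
... | yes _   | _       | yes _   | _       = cong (_∸ 2) (ext-toℕ D x)
... | yes x≡a | _       | no  x≢a | _       = ⊥-elim (x≢a (cong toℕ x≡a))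
... | no  x≢a | _       | yes x≡a | _       = ⊥-elim (x≢a (toℕ-injective x≡a))
... | no _    | yes _   | no _    | yes _   = cong suc (ext-toℕ D x)
... | no _    | yes x≡b | no _    | no  x≢b = ⊥-elim (x≢b (cong toℕ x≡b))
... | no _    | no  x≢b | no _    | yes x≡b = ⊥-elim (x≢b (toℕ-injective x≡b))
... | no _    | no _    | no _    | no _    = ext-toℕ D x

ext-move : ∀ {n} (a b : Fin n) D k → ext (moveDist a b D) k ≡ shift (toℕ a) (toℕ b) (ext D) k
ext-move {n} a b D k with k <? n
... | yes k<n = begin
  moveDist a b D (fromℕ< k<n)                          ≡⟨ shift-toℕ a b (fromℕ< k<n) D ⟨
  shift (toℕ a) (toℕ b) (ext D) (toℕ (fromℕ< k<n))     ≡⟨ cong (shift (toℕ a) (toℕ b) (ext D)) (toℕ-fromℕ< k<n) ⟩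
  shift (toℕ a) (toℕ b) (ext D) k                      ∎
  where open ≡-Reasoning
... | no k≮n = sym (trans (shift-other _ _ (ext D) k (k≢ a) (k≢ b)) (ext-out D k≮n))
  where
  k≢ : (x : Fin n) → k ≢ toℕ x
  k≢ x refl = k≮n (toℕ<n x)

capAt : (ℕ → ℕ) → ℕ → ℕ → ℕ
capAt g N t = cap g t (N ∸ suc t)

capacity : ∀ {n} → Distribution n → Fin n → ℕ
capacity {n} D x = capAt (ext D) n (toℕ x)

window-bound : ∀ {a t n} → a < n → t < n → a ≤ t + (n ∸ suc t)
window-bound a<n t<n = ≤-pred (≤-trans a<n (≤-reflexive (sym (m+[n∸m]≡n t<n))))

capacity-move : ∀ {n} {D E : Distribution n} x → Move PathAdj D E → capacity E x ≤ capacity D x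
capacity-move {n} {D} x (move a b adj 2≤Da) = begin
  capacity (moveDist a b D) x
    ≡⟨ cap-cong (toℕ x) (n ∸ suc (toℕ x)) (ext-move a b D) ⟩
  cap (shift (toℕ a) (toℕ b) (ext D)) (toℕ x) (n ∸ suc (toℕ x))
    ≤⟨ cap-shift (toℕ x) _ (ext D) adj (≤-trans 2≤Da (≤-reflexive (sym (ext-toℕ D a))))
                 (window-bound (toℕ<n a) (toℕ<n x)) ⟩
  capacity D x ∎
  where open ≤-Reasoning

capacity-reaches : ∀ {n} {D E : Distribution n} x → Reaches PathAdj D E → capacity E x ≤ capacity D x
capacity-reaches x ε         = ≤-refl
capacity-reaches x (m ◅ D↝E) = ≤-trans (capacity-reaches x D↝E) (capacity-move x m)

unreachable : ∀ {n} (D : Distribution n) x → capacity D x ≤ 1 → ¬ TwoReachable PathAdj D x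
unreachable D x cap≤1 (E , D↝E , 2≤Ex) = 1+n≰n (begin
  2                                       ≤⟨ 2≤Ex ⟩
  E x                                     ≡⟨ ext-toℕ E x ⟨
  ext E (toℕ x)                           ≤⟨ ≤-trans (m≤m+n _ _) (m≤m+n _ _) ⟩
  capacity E x                            ≤⟨ capacity-reaches x D↝E ⟩
  capacity D x                            ≤⟨ cap≤1 ⟩
  1                                       ∎)
  where open ≤-Reasoning

step : ∀ {n} {a b} (D : Distribution n) → a < n → b < n → Adj a b → 2 ≤ ext D a →
  ∃ λ E → Move PathAdj D E × (∀ k → ext E k ≡ shift a b (ext D) k)
step {n} D a<n b<n adj 2≤Da =
  moveDist x y D , move x y adj′ (≤-trans 2≤Da (≤-reflexive (ext-in D a<n))) ,
  λ k → trans (ext-move x y D k) (cong₂ (λ p q → shift p q (ext D) k) (toℕ-fromℕ< a<n) (toℕ-fromℕ< b<n))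
  where
  x y : Fin n
  x = fromℕ< a<n
  y = fromℕ< b<n
  adj′ : PathAdj x y
  adj′ = subst₂ Adj (sym (toℕ-fromℕ< a<n)) (sym (toℕ-fromℕ< b<n)) adj

push : ∀ {n} j {a b} (D : Distribution n) → a < n → b < n → Adj a b → j + j ≤ ext D a →
  ∃ λ E → Reaches PathAdj D E × ext E b ≡ ext D b + j ×
          (∀ {k} → k ≢ a → k ≢ b → ext E k ≡ ext D k)
push zero D _ _ _ _ = D , ε , sym (+-identityʳ _) , λ _ _ → refl
push (suc j) {a} {b} D a<n b<n adj 2j+2≤Da =
  let D₁ , D→D₁ , D₁≗ = step D a<n b<n adj (m+n≤o⇒m≤o 2 2+2j≤Da)
      E , D₁↝E , E-at-b , E-else = push j D₁ a<n b<n adj (≤-trans (∸-monoˡ-≤ 2 2+2j≤Da)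
                                     (≤-reflexive (sym (trans (D₁≗ a) (shift-source a b (ext D))))))
  in E , D→D₁ ◅ D₁↝E ,
     trans E-at-b (trans (cong (_+ j) (trans (D₁≗ b) (shift-target a b (ext D) (adj⇒≢ adj))))
                         (sym (+-suc _ j))) ,
     λ k≢a k≢b → trans (E-else k≢a k≢b) (trans (D₁≗ _) (shift-other a b (ext D) _ k≢a k≢b))
  where
  2+2j≤Da : 2 + (j + j) ≤ ext D a
  2+2j≤Da = ≤-trans (≤-reflexive (cong suc (sym (+-suc j j)))) 2j+2≤Da

halves-available : ∀ x → ⌊ x /2⌋ + ⌊ x /2⌋ ≤ x
halves-available x = ≤-trans (+-monoʳ-≤ ⌊ x /2⌋ (⌊n/2⌋≤⌈n/2⌉ x)) (≤-reflexive (⌊n/2⌋+⌈n/2⌉≡n x))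

gather-left : ∀ {n} (D : Distribution n) t → t < n →
  ∃ λ E → Reaches PathAdj D E × ext E t ≡ loadL (ext D) t ×
          (∀ {k} → t < k → ext E k ≡ ext D k)
gather-left D zero _ = D , ε , sym (+-identityʳ _) , λ _ → refl
gather-left D (suc t) 1+t<n =
  let D₁ , D↝D₁ , D₁-at-t , D₁-right = gather-left D t t<n
      E , D₁↝E , E-at-1+t , E-else =
        push ⌊ ext D₁ t /2⌋ D₁ t<n 1+t<n (inj₁ refl) (halves-available (ext D₁ t))
  in E , D↝D₁ ◅◅ D₁↝E ,
     trans E-at-1+t (cong₂ (λ x y → x + ⌊ y /2⌋) (D₁-right (n<1+n t)) D₁-at-t) ,
     λ 1+t<k → trans (E-else (>⇒≢ (<-trans (n<1+n t) 1+t<k)) (>⇒≢ 1+t<k))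
                     (D₁-right (<-trans (n<1+n t) 1+t<k))
  where
  t<n : t < _
  t<n = <-trans (n<1+n t) 1+t<n

gather-right : ∀ {n} (D : Distribution n) t m → t + m < n →
  ∃ λ E → Reaches PathAdj D E × ext E t ≡ loadR (ext D) t m ×
          (∀ {k} → k < t → ext E k ≡ ext D k)
gather-right D t zero _ = D , ε , sym (+-identityʳ _) , λ _ → refl
gather-right D t (suc m) t+1+m<n =
  let D₁ , D↝D₁ , D₁-at-1+t , D₁-left = gather-right D (suc t) m 1+t+m<n
      E , D₁↝E , E-at-t , E-else =
        push ⌊ ext D₁ (suc t) /2⌋ D₁ 1+t<n t<n (inj₂ refl) (halves-available (ext D₁ (suc t)))
  in E , D↝D₁ ◅◅ D₁↝E ,
     trans E-at-t (cong₂ (λ x y → x + ⌊ y /2⌋) (D₁-left (n<1+n t)) D₁-at-1+t) ,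
     λ k<t → trans (E-else (<⇒≢ (m<n⇒m<1+n k<t)) (<⇒≢ k<t)) (D₁-left (m<n⇒m<1+n k<t))
  where
  1+t+m<n : suc t + m < _
  1+t+m<n = ≤-trans (≤-reflexive (cong suc (sym (+-suc t m)))) t+1+m<n
  1+t<n : suc t < _
  1+t<n = ≤-<-trans (m≤m+n (suc t) m) 1+t+m<n
  t<n : t < _
  t<n = <-trans (n<1+n t) 1+t<n

-- Gathering from both sides realises the capacity.
reachable : ∀ {n} (D : Distribution n) x → 2 ≤ capacity D x → TwoReachable PathAdj D x
reachable {n} D x 2≤cap =
  let t = toℕ x
      m = n ∸ suc t
      D₁ , D↝D₁ , D₁-at-t , D₁-right = gather-left D t (toℕ<n x)
      E , D₁↝E , E-at-t , _ = gather-right D₁ t m (≤-reflexive (m+[n∸m]≡n (toℕ<n x)))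
      open ≤-Reasoning
  in E , D↝D₁ ◅◅ D₁↝E , (begin
       2                                ≤⟨ 2≤cap ⟩
       loadL (ext D) t + inR (ext D) t m ≡⟨ cong₂ _+_ D₁-at-t (inR-local t m D₁-right) ⟨
       loadR (ext D₁) t m               ≡⟨ E-at-t ⟨
       ext E t                          ≡⟨ ext-toℕ E x ⟩
       E x                              ∎)

small-half : ∀ {x} → x ≤ 1 → ⌊ x /2⌋ ≡ 0
small-half z≤n       = refl
small-half (s≤s z≤n) = refl

one-small : ∀ A B → ⌊ A /2⌋ + ⌊ B /2⌋ ≤ 1 → A ≤ 1 ⊎ B ≤ 1
one-small 0 B _ = inj₁ z≤n
one-small 1 B _ = inj₁ (s≤s z≤n)
one-small (suc (suc A)) 0 _ = inj₂ z≤n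
one-small (suc (suc A)) 1 _ = inj₂ (s≤s z≤n)
one-small (suc (suc A)) (suc (suc B)) (s≤s h) with m+n≤o⇒n≤o ⌊ A /2⌋ h
... | ()

-- With A the left load at u, c the pebbles on v and B the right load at w,
-- the three capacities are A + ⌊(c + ⌊B/2⌋)/2⌋, c + ⌊A/2⌋ + ⌊B/2⌋ and
-- B + ⌊(c + ⌊A/2⌋)/2⌋.
capacity-core : ∀ A c B → c + ⌊ A /2⌋ + ⌊ B /2⌋ ≤ 1 →
  A + ⌊ c + ⌊ B /2⌋ /2⌋ ≤ 1 ⊎ B + ⌊ c + ⌊ A /2⌋ /2⌋ ≤ 1
capacity-core A c B h = Sum.map (bound A (c + ⌊ B /2⌋) c+B≤1) (bound B (c + ⌊ A /2⌋) c+A≤1)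
                                (one-small A B A+B≤1)
  where
  bound : ∀ X y → y ≤ 1 → X ≤ 1 → X + ⌊ y /2⌋ ≤ 1
  bound X y y≤1 X≤1 = ≤-trans (≤-reflexive (trans (cong (X +_) (small-half y≤1)) (+-identityʳ X))) X≤1
  c+A≤1 : c + ⌊ A /2⌋ ≤ 1
  c+A≤1 = ≤-trans (m≤m+n (c + ⌊ A /2⌋) _) h
  c+B≤1 : c + ⌊ B /2⌋ ≤ 1
  c+B≤1 = ≤-trans (+-monoˡ-≤ ⌊ B /2⌋ (m≤m+n c _)) h
  A+B≤1 : ⌊ A /2⌋ + ⌊ B /2⌋ ≤ 1
  A+B≤1 = ≤-trans (≤-trans (m≤n+m _ c) (≤-reflexive (sym (+-assoc c _ _)))) h

cap-triple : ∀ g t m → cap g (suc t) (suc m) ≤ 1 →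
  cap g t (suc (suc m)) ≤ 1 ⊎ cap g (suc (suc t)) m ≤ 1
cap-triple g t m h =
  Sum.map₂ (≤-trans (≤-reflexive (xy∙z≈xz∙y (g (suc (suc t))) (inL g (suc (suc t))) (inR g (suc (suc t)) m))))
           (capacity-core (loadL g t) (g (suc t)) (loadR g (suc (suc t)) m) h)

window-step : ∀ {N t} → t < N → N ∸ t ≡ suc (N ∸ suc t)
window-step = +-∸-assoc 1

capAt-neighbours : ∀ g {N} t → suc (suc t) < N → capAt g N (suc t) ≤ 1 →
  capAt g N t ≤ 1 ⊎ capAt g N (suc (suc t)) ≤ 1
capAt-neighbours g {N} t w<N h =
  Sum.map₁ (subst (λ k → cap g t k ≤ 1) (sym window-u))
           (cap-triple g t m (subst (λ k → cap g (suc t) k ≤ 1) window-v h))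
  where
  m : ℕ
  m = N ∸ suc (suc (suc t))
  window-v : N ∸ suc (suc t) ≡ suc m
  window-v = window-step w<N
  window-u : N ∸ suc t ≡ suc (suc m)
  window-u = trans (window-step (<-trans (n<1+n _) w<N)) (cong suc window-v)

claim6 : (n : ℕ) (D : Distribution n) (u v w : Fin n) →
    suc (toℕ u) ≡ toℕ v → suc (toℕ v) ≡ toℕ w →
    ¬ TwoReachable PathAdj D v →
    ¬ TwoReachable PathAdj D u ⊎ ¬ TwoReachable PathAdj D w
claim6 n D u v w u→v v→w v-unreachable with capacity D v ≤? 1
... | no  cap≰1 = ⊥-elim (v-unreachable (reachable D v (≰⇒> cap≰1)))
... | yes cap≤1 =
  Sum.map (unreachable D u) (unreachable D w ∘ subst (λ t → capAt (ext D) n t ≤ 1) (sym w≡u+2))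
          (capAt-neighbours (ext D) (toℕ u) (subst (_< n) w≡u+2 (toℕ<n w))
                            (subst (λ t → capAt (ext D) n t ≤ 1) (sym u→v) cap≤1))
  where
  w≡u+2 : toℕ w ≡ suc (suc (toℕ u))
  w≡u+2 = trans (sym v→w) (cong suc (sym u→v))
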